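{- Let $f:\mathbb{N}\to\mathbb{R}$ be a nonnegative multiplicative function with $f(1)=1$, and let $k\ge2$ be a fixed integer. If for every prime $p$ and all integers $a,b\ge0$ one has $\big(f(p^{a+b})\big)^k\le p^{ka} f(p^{kb})$ (resp. $\big(f(p^{a+b})\big)^k\ge p^{ka} f(p^{kb})$), then $f$ is $k$-sub-homogeneous (resp. $k$-super-homogeneous).
   Context: $\mathbb{N}=\{1,2,3,\dots\}$. $f$ is multiplicative if $f(mn)=f(m)f(n)$ whenever $\gcd(m,n)=1$. $f$ is $k$-sub-homogeneous if $\big(f(mn)\big)^k\le m^k f(n^k)$ for all $m,n\ge1$, and $k$-super-homogeneous if $\big(f(mn)\big)^k\ge m^k f(n^k)$ for all $m,n\ge1$. -}

module Defs where

open import Level using (Level; _⊔_; suc)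
open import Data.Nat as ℕ using (ℕ; _≥_)
import Data.Nat.Primality as P
open import Data.Nat.Coprimality using (Coprime)
open import Algebra.Bundles using (CommutativeSemiring)
open import Relation.Binary.Structures using (IsPreorder)
import Algebra.Definitions.RawSemiring as RS

-- An ordered commutative semiring: the only structure of ℝ used by the
-- statement (sums, products, natural-number embedding, powers, order).
-- ℝ (with its usual order) is an instance.
record OrderedCommutativeSemiring (c ℓ₁ ℓ₂ : Level) : Set (Level.suc (c ⊔ ℓ₁ ⊔ ℓ₂)) where
  field
    commutativeSemiring : CommutativeSemiring c ℓ₁
  open CommutativeSemiring commutativeSemiring public
  field
    _≤_       : Carrier → Carrier → Set ℓ₂
    isPreorder : IsPreorder _≈_ _≤_
    0≤1       : 0# ≤ 1#
    +-monoˡ-≤ : ∀ {a b} c → a ≤ b → (a + c) ≤ (b + c)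
    *-monoˡ-≤ : ∀ {a b c} → 0# ≤ c → a ≤ b → (a * c) ≤ (b * c)
  open RS rawSemiring public using (_×_; _^_)

  ι : ℕ → Carrier
  ι n = n × 1#

module _ {c ℓ₁ ℓ₂} (R : OrderedCommutativeSemiring c ℓ₁ ℓ₂) where
  open OrderedCommutativeSemiring R

  Nonnegative : (ℕ → Carrier) → Set (ℓ₂)
  Nonnegative f = ∀ n → n ≥ 1 → 0# ≤ f n

  Multiplicative : (ℕ → Carrier) → Set ℓ₁
  Multiplicative f = ∀ m n → m ≥ 1 → n ≥ 1 → Coprime m n → f (m ℕ.* n) ≈ f m * f n

  SubHomogeneous : ℕ → (ℕ → Carrier) → Set ℓ₂
  SubHomogeneous k f = ∀ m n → m ≥ 1 → n ≥ 1 →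
    (f (m ℕ.* n) ^ k) ≤ (ι (m ℕ.^ k) * f (n ℕ.^ k))

  SuperHomogeneous : ℕ → (ℕ → Carrier) → Set ℓ₂
  SuperHomogeneous k f = ∀ m n → m ≥ 1 → n ≥ 1 →
    (ι (m ℕ.^ k) * f (n ℕ.^ k)) ≤ (f (m ℕ.* n) ^ k)

  PrimePowerSub : ℕ → (ℕ → Carrier) → Set ℓ₂
  PrimePowerSub k f = ∀ p → P.Prime p → ∀ a b →
    (f (p ℕ.^ (a ℕ.+ b)) ^ k) ≤ (ι (p ℕ.^ (k ℕ.* a)) * f (p ℕ.^ (k ℕ.* b)))

  PrimePowerSuper : ℕ → (ℕ → Carrier) → Set ℓ₂
  PrimePowerSuper k f = ∀ p → P.Prime p → ∀ a b →
    (ι (p ℕ.^ (k ℕ.* a)) * f (p ℕ.^ (k ℕ.* b))) ≤ (f (p ℕ.^ (a ℕ.+ b)) ^ k)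

-- For a prime p dividing mn write m = p^a m′ and n = p^b n′ with p ∤ m′ n′.
-- Multiplicativity splits both sides of (f(mn))^k ≤ m^k f(n^k) into a p-part
-- and a p-free part; the p-part is the prime-power condition for (p, a, b) and
-- the p-free part is the same inequality for (m′, n′), with m′ n′ < mn. Since all
-- factors are nonnegative the two inequalities multiply, and strong induction on
-- mn finishes. The super-homogeneous case is the same argument for the reversed
-- order.

module Submission where

open import Defs
open import Data.Nat as ℕ using (ℕ; zero; suc; NonZero; _≥_; _<_)
open import Data.Nat.Properties as ℕ using ()
open import Data.Nat.Divisibility using (_∤_)
open import Data.Nat.Primality using (Prime; prime[2]; prime⇒nonZero)
open import Data.Nat.Coprimality using (Coprime)
open import Data.Product using (_×_; _,_; ∃-syntax)
open import Function.Base using (flip)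
open import Induction.WellFounded using (Acc; acc)
open import Data.Nat.Induction using (<-wellFounded)
open import Relation.Binary.Core using (Rel)
open import Relation.Binary.Structures using (IsPreorder)
import Relation.Binary.Construct.Flip.EqAndOrd as Flip
open import Relation.Binary.PropositionalEquality as ≡ using (_≡_; refl)
open import Relation.Nullary using (yes; no; contradiction)

module _ where
  open import Data.Nat
  open import Data.Nat.Properties
  open import Data.Nat.Divisibility
  open import Data.Nat.Primality
  open import Data.Nat.Primality.Factorisation using (factorise)
  open import Data.Nat.Coprimality using (coprime-factors)
  open import Data.List using ([]; _∷_)
  open import Data.List.Relation.Unary.All using (_∷_)
  open import Data.Sum using (inj₁; inj₂)
  open ≡ using (sym; cong; subst)
  open ≡.≡-Reasoning

  private variable e m n o p : ℕ

  ^-distribʳ-* : ∀ m n k → (m * n) ^ k ≡ m ^ k * n ^ k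
  ^-distribʳ-* m n zero    = refl
  ^-distribʳ-* m n (suc k) = begin
    m * n * (m * n) ^ k      ≡⟨ cong (m * n *_) (^-distribʳ-* m n k) ⟩
    m * n * (m ^ k * n ^ k)  ≡⟨ [m*n]*[o*p]≡[m*o]*[n*p] m n (m ^ k) (n ^ k) ⟩
    m * m ^ k * (n * n ^ k)  ∎

  [p^a*m]*[p^b*n]≡p^[a+b]*[m*n] : ∀ p a b m n →
    (p ^ a * m) * (p ^ b * n) ≡ p ^ (a + b) * (m * n)
  [p^a*m]*[p^b*n]≡p^[a+b]*[m*n] p a b m n = begin
    (p ^ a * m) * (p ^ b * n)  ≡⟨ [m*n]*[o*p]≡[m*o]*[n*p] (p ^ a) m (p ^ b) n ⟩
    (p ^ a * p ^ b) * (m * n)  ≡⟨ cong (_* (m * n)) (^-distribˡ-+-* p a b) ⟨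
    p ^ (a + b) * (m * n)      ∎

  [p^a*m]^k≡p^[k*a]*m^k : ∀ p a m k → (p ^ a * m) ^ k ≡ p ^ (k * a) * m ^ k
  [p^a*m]^k≡p^[k*a]*m^k p a m k = begin
    (p ^ a * m) ^ k        ≡⟨ ^-distribʳ-* (p ^ a) m k ⟩
    (p ^ a) ^ k * m ^ k    ≡⟨ cong (_* m ^ k) (^-*-assoc p a k) ⟩
    p ^ (a * k) * m ^ k    ≡⟨ cong (λ e → p ^ e * m ^ k) (*-comm a k) ⟩
    p ^ (k * a) * m ^ k    ∎

  ∤⇒nonZero : p ∤ n → NonZero n
  ∤⇒nonZero {p} {zero}  p∤0 = contradiction (p ∣0) p∤0
  ∤⇒nonZero {n = suc _} _   = _

  ∤⇒>0 : p ∤ n → n > 0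
  ∤⇒>0 {n = n} p∤n = >-nonZero⁻¹ n {{∤⇒nonZero p∤n}}

  ∤-* : Prime p → p ∤ m → p ∤ n → p ∤ m * n
  ∤-* {m = m} {n} p-prime p∤m p∤n p∣mn with euclidsLemma m n p-prime p∣mn
  ... | inj₁ p∣m = p∤m p∣m
  ... | inj₂ p∣n = p∤n p∣n

  ∤-^ : Prime p → p ∤ n → ∀ k → p ∤ n ^ k
  ∤-^ p-prime p∤n zero    p∣1 = nonTrivial⇒≢1 {{prime⇒nonTrivial p-prime}} (∣1⇒≡1 p∣1)
  ∤-^ p-prime p∤n (suc k) = ∤-* p-prime p∤n (∤-^ p-prime p∤n k)

  prime∤⇒coprime : Prime p → p ∤ n → Coprime p n
  prime∤⇒coprime p-prime p∤n (d∣p , d∣n) with prime⇒irreducible p-prime d∣p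
  ... | inj₁ d≡1 = d≡1
  ... | inj₂ refl = contradiction d∣n p∤n

  coprime-*ˡ : Coprime m o → Coprime n o → Coprime (m * n) o
  coprime-*ˡ {n = n} m⊥o n⊥o (d∣mn , d∣o) =
    n⊥o (coprime-factors m⊥o (d∣mn , ∣m⇒∣m*n n d∣o) , d∣o)

  coprime-^ˡ : ∀ e → Coprime m n → Coprime (m ^ e) n
  coprime-^ˡ zero    m⊥n (d∣1 , _) = ∣1⇒≡1 d∣1
  coprime-^ˡ (suc e) m⊥n          = coprime-*ˡ m⊥n (coprime-^ˡ e m⊥n)

  ∃-prime-∣ : ∀ n → 1 < n → ∃[ p ] Prime p × p ∣ n
  ∃-prime-∣ n@(suc _) 1<n with factorise n
  ... | record { factors = [] ; isFactorisation = n≡1 } =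
    contradiction (sym n≡1) (<⇒≢ 1<n)
  ... | record { factors = p ∷ ps ; isFactorisation = n≡p*Πps ; factorsPrime = p-prime ∷ _ } =
    p , p-prime , subst (p ∣_) (sym n≡p*Πps) (m∣m*n _)

  ∣p^e*n⇒n<p^e*n : Prime p → p ∤ n → p ∣ p ^ e * n → n < p ^ e * n
  ∣p^e*n⇒n<p^e*n {n = n} {zero} p-prime p∤n p∣1*n =
    contradiction (subst (_ ∣_) (*-identityˡ n) p∣1*n) p∤n
  ∣p^e*n⇒n<p^e*n {p} {n} {suc e} p-prime p∤n _ =
    subst (n <_) (*-comm n _) (m<m*n n (p ^ suc e) {{∤⇒nonZero p∤n}} 1<p^[1+e])
    where
    1<p^[1+e] : 1 < p ^ suc e
    1<p^[1+e] = ^-monoʳ-< p (nonTrivial⇒n>1 p {{prime⇒nonTrivial p-prime}}) {0} {suc e} z<s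

  cofactors< : ∀ a b → Prime p → p ∤ m → p ∤ n → p ∣ (p ^ a * m) * (p ^ b * n) →
               m * n < (p ^ a * m) * (p ^ b * n)
  cofactors< {p} {m} {n} a b p-prime p∤m p∤n
    rewrite [p^a*m]*[p^b*n]≡p^[a+b]*[m*n] p a b m n =
    ∣p^e*n⇒n<p^e*n {e = a + b} p-prime (∤-* p-prime p∤m p∤n)

  record Split (p n : ℕ) : Set where
    constructor mkSplit
    field
      exponent cofactor : ℕ
      decomposition : n ≡ p ^ exponent * cofactor
      p∤cofactor : p ∤ cofactor

  split-acc : Prime p → ∀ n → .{{NonZero n}} → Acc _<_ n → Split p n
  split-acc {p} p-prime n (acc rec) with p ∣? n
  ... | no p∤n = mkSplit 0 n (sym (*-identityˡ n)) p∤n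
  ... | yes p∣n with split-acc p-prime (quotient p∣n) {{quotient≢0 p∣n}}
                       (rec (quotient-< p∣n {{prime⇒nonTrivial p-prime}}))
  ...   | mkSplit e c q≡p^e*c p∤c = mkSplit (suc e) c n≡p^[1+e]*c p∤c
    where
    n≡p^[1+e]*c : n ≡ p ^ suc e * c
    n≡p^[1+e]*c = begin
      n                   ≡⟨ m∣n⇒n≡m*quotient p∣n ⟩
      p * quotient p∣n    ≡⟨ cong (p *_) q≡p^e*c ⟩
      p * (p ^ e * c)     ≡⟨ *-assoc p (p ^ e) c ⟨
      p ^ suc e * c       ∎

  split : Prime p → ∀ n → .{{NonZero n}} → Split p n
  split p-prime n = split-acc p-prime n (<-wellFounded n)

module _ {c ℓ₁ ℓ₂} (R : OrderedCommutativeSemiring c ℓ₁ ℓ₂) where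
  open OrderedCommutativeSemiring R
  open import Algebra.Properties.CommutativeSemiring.Exp commutativeSemiring using (^-distrib-*)
  open import Algebra.Properties.Semiring.Exp semiring using (^-congˡ)
  open import Algebra.Properties.Semiring.Mult semiring using (×1-homo-*)
  open import Algebra.Properties.CommutativeSemigroup *-commutativeSemigroup using (interchange)
  module ≤ = IsPreorder isPreorder

  private variable x y u v : Carrier

  0≤* : 0# ≤ x → 0# ≤ y → 0# ≤ (x * y)
  0≤* {x} {y} 0≤x 0≤y = ≤.trans (≤.reflexive (sym (zeroˡ y))) (*-monoˡ-≤ 0≤y 0≤x)

  0≤^ : ∀ n → 0# ≤ x → 0# ≤ (x ^ n)
  0≤^ zero    0≤x = 0≤1
  0≤^ (suc n) 0≤x = 0≤* 0≤x (0≤^ n 0≤x)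

  0≤ι : ∀ n → 0# ≤ ι n
  0≤ι zero    = ≤.refl
  0≤ι (suc n) = ≤.trans (0≤ι n)
    (≤.trans (≤.reflexive (sym (+-identityˡ (ι n)))) (+-monoˡ-≤ (ι n) 0≤1))

  *-MonotoneOnNonnegatives : ∀ {ℓ} → Rel Carrier ℓ → Set _
  *-MonotoneOnNonnegatives _⊑_ = ∀ {x y u v} → 0# ≤ x → 0# ≤ y → 0# ≤ u → 0# ≤ v →
    x ⊑ y → u ⊑ v → (x * u) ⊑ (y * v)

  *-mono-≤ : *-MonotoneOnNonnegatives _≤_
  *-mono-≤ {y = y} {u} {v} _ 0≤y 0≤u _ x≤y u≤v = begin
    _ * u  ≲⟨ *-monoˡ-≤ 0≤u x≤y ⟩
    y * u  ≈⟨ *-comm y u ⟩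
    u * y  ≲⟨ *-monoˡ-≤ 0≤y u≤v ⟩
    v * y  ≈⟨ *-comm v y ⟩
    y * v  ∎
    where open import Relation.Binary.Reasoning.Base.Double isPreorder

  *-mono-≥ : *-MonotoneOnNonnegatives (flip _≤_)
  *-mono-≥ 0≤x 0≤y 0≤u 0≤v y≤x v≤u = *-mono-≤ 0≤y 0≤x 0≤v 0≤u y≤x v≤u

  module _ {ℓ} {_⊑_ : Rel Carrier ℓ} (⊑-isPreorder : IsPreorder _≈_ _⊑_)
           (*-mono-⊑ : *-MonotoneOnNonnegatives _⊑_)
           {f : ℕ → Carrier} (k : ℕ) (f≥0 : Nonnegative R f) (f-* : Multiplicative R f)
           (f-primePower : ∀ p → Prime p → ∀ a b →
              (f (p ℕ.^ (a ℕ.+ b)) ^ k) ⊑ (ι (p ℕ.^ (k ℕ.* a)) * f (p ℕ.^ (k ℕ.* b))))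
           where
    open import Relation.Binary.Reasoning.Base.Double ⊑-isPreorder

    Homogeneous : ℕ → ℕ → Set ℓ
    Homogeneous m n = (f (m ℕ.* n) ^ k) ⊑ (ι (m ℕ.^ k) * f (n ℕ.^ k))

    f-p^e*n : ∀ {p n} e → Prime p → p ∤ n → f (p ℕ.^ e ℕ.* n) ≈ f (p ℕ.^ e) * f n
    f-p^e*n {p} {n} e p-prime p∤n =
      f-* (p ℕ.^ e) n (ℕ.m^n>0 p {{prime⇒nonZero p-prime}} e) (∤⇒>0 p∤n)
        (coprime-^ˡ e (prime∤⇒coprime p-prime p∤n))

    homogeneous-1-1 : Homogeneous 1 1
    homogeneous-1-1 = ≡.subst (λ n → (f 1 ^ k) ⊑ (ι n * f n))
      (≡.trans (≡.cong (2 ℕ.^_) (ℕ.*-zeroʳ k)) (≡.sym (ℕ.^-zeroˡ k)))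
      (f-primePower 2 prime[2] 0 0)

    homogeneous-extend : ∀ {p m n} → Prime p → p ∤ m → p ∤ n → ∀ a b →
      Homogeneous m n → Homogeneous (p ℕ.^ a ℕ.* m) (p ℕ.^ b ℕ.* n)
    homogeneous-extend {p} {m} {n} p-prime p∤m p∤n a b hom-m-n = begin
      f (p ℕ.^ a ℕ.* m ℕ.* (p ℕ.^ b ℕ.* n)) ^ k
        ≡⟨ ≡.cong (λ N → f N ^ k) ([p^a*m]*[p^b*n]≡p^[a+b]*[m*n] p a b m n) ⟩
      f (p ℕ.^ (a ℕ.+ b) ℕ.* (m ℕ.* n)) ^ k
        ≈⟨ ^-congˡ k (f-p^e*n (a ℕ.+ b) p-prime p∤mn) ⟩
      (f (p ℕ.^ (a ℕ.+ b)) * f (m ℕ.* n)) ^ k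
        ≈⟨ ^-distrib-* (f (p ℕ.^ (a ℕ.+ b))) (f (m ℕ.* n)) k ⟩
      f (p ℕ.^ (a ℕ.+ b)) ^ k * f (m ℕ.* n) ^ k
        ∼⟨ *-mono-⊑ (0≤^ k (0≤f[p^ (a ℕ.+ b)]))
                    (0≤* (0≤ι (p ℕ.^ (k ℕ.* a))) (0≤f[p^ (k ℕ.* b)]))
                    (0≤^ k (f≥0 (m ℕ.* n) (∤⇒>0 p∤mn)))
                    (0≤* (0≤ι (m ℕ.^ k)) (f≥0 (n ℕ.^ k) (∤⇒>0 p∤nᵏ)))
                    (f-primePower p p-prime a b) hom-m-n ⟩
      (ι (p ℕ.^ (k ℕ.* a)) * f (p ℕ.^ (k ℕ.* b))) * (ι (m ℕ.^ k) * f (n ℕ.^ k))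
        ≈⟨ interchange (ι (p ℕ.^ (k ℕ.* a))) (f (p ℕ.^ (k ℕ.* b)))
                       (ι (m ℕ.^ k)) (f (n ℕ.^ k)) ⟩
      (ι (p ℕ.^ (k ℕ.* a)) * ι (m ℕ.^ k)) * (f (p ℕ.^ (k ℕ.* b)) * f (n ℕ.^ k))
        ≈⟨ *-cong (×1-homo-* (p ℕ.^ (k ℕ.* a)) (m ℕ.^ k))
                  (f-p^e*n (k ℕ.* b) p-prime p∤nᵏ) ⟨
      ι (p ℕ.^ (k ℕ.* a) ℕ.* m ℕ.^ k) * f (p ℕ.^ (k ℕ.* b) ℕ.* n ℕ.^ k)
        ≡⟨ ≡.cong₂ (λ M N → ι M * f N) ([p^a*m]^k≡p^[k*a]*m^k p a m k)
                                        ([p^a*m]^k≡p^[k*a]*m^k p b n k) ⟨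
      ι ((p ℕ.^ a ℕ.* m) ℕ.^ k) * f ((p ℕ.^ b ℕ.* n) ℕ.^ k)
        ∎
      where
      p∤mn : p ∤ m ℕ.* n
      p∤mn = ∤-* p-prime p∤m p∤n
      p∤nᵏ : p ∤ n ℕ.^ k
      p∤nᵏ = ∤-^ p-prime p∤n k
      0≤f[p^_] : ∀ e → 0# ≤ f (p ℕ.^ e)
      0≤f[p^ e ] = f≥0 (p ℕ.^ e) (ℕ.m^n>0 p {{prime⇒nonZero p-prime}} e)

    homogeneous-acc : ∀ m n → .{{NonZero m}} → .{{NonZero n}} → Acc _<_ (m ℕ.* n) →
                      Homogeneous m n
    homogeneous-acc m n (acc rec) with m ℕ.* n ℕ.≟ 1
    ... | yes mn≡1 = ≡.subst₂ Homogeneous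
      (≡.sym (ℕ.m*n≡1⇒m≡1 m n mn≡1)) (≡.sym (ℕ.m*n≡1⇒n≡1 m n mn≡1)) homogeneous-1-1
    ... | no mn≢1
      with ∃-prime-∣ (m ℕ.* n)
             (ℕ.≤∧≢⇒< (ℕ.>-nonZero⁻¹ _ {{ℕ.m*n≢0 m n}})
                       (λ 1≡mn → mn≢1 (≡.sym 1≡mn)))
    ...   | p , p-prime , p∣mn with split p-prime m | split p-prime n
    ...     | mkSplit a m′ refl p∤m′ | mkSplit b n′ refl p∤n′ =
      homogeneous-extend p-prime p∤m′ p∤n′ a b
        (homogeneous-acc m′ n′ {{∤⇒nonZero p∤m′}} {{∤⇒nonZero p∤n′}}
          (rec (cofactors< a b p-prime p∤m′ p∤n′ p∣mn)))

    homogeneous : ∀ m n → m ≥ 1 → n ≥ 1 → Homogeneous m n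
    homogeneous m n m≥1 n≥1 =
      homogeneous-acc m n {{ℕ.>-nonZero m≥1}} {{ℕ.>-nonZero n≥1}} (<-wellFounded _)

theorem9 : ∀ {c ℓ₁ ℓ₂} (R : OrderedCommutativeSemiring c ℓ₁ ℓ₂)
    (f : ℕ → OrderedCommutativeSemiring.Carrier R) (k : ℕ) →
    Nonnegative R f → Multiplicative R f →
    OrderedCommutativeSemiring._≈_ R (f 1) (OrderedCommutativeSemiring.1# R) →
    k ≥ 2 →
    (PrimePowerSub R k f → SubHomogeneous R k f) ×
    (PrimePowerSuper R k f → SuperHomogeneous R k f)
-- Neither f 1 ≈ 1# nor k ≥ 2 is needed: the base case m = n = 1 is the
-- prime-power condition with a = b = 0.
theorem9 R f k f≥0 f-* _ _ =
    homogeneous R isPreorder (*-mono-≤ R) k f≥0 f-*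
  , homogeneous R (Flip.isPreorder isPreorder) (*-mono-≥ R) k f≥0 f-*
  where open OrderedCommutativeSemiring R using (isPreorder)
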